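{- Let $U$ be a subset of $\mathcal{S}$ and let $[m,M]=[\inf U,\sup U]$ be the smallest interval containing $U$. Then $\bigcup_{x\in U}B(x)=B(m)\cup B(M)$.
   Context: $\mathcal{S}=[0,C]\subset\mathbb{Z}^d$ with the componentwise order. $a$ is an almost space homogeneous event (ASHE) with direction vector $v\in\mathbb{Z}^d$ and blocking relation $\mathcal{R}$ on $\{1,\dots,d\}$: with $CR(x)=\{i: x_i+v_i\notin[0,C_i]\}$ (critical components) and $B(x)=\{i:\exists j\in CR(x),(j,i)\in\mathcal{R}\}$ (blocked components), $(x\cdot a)_i=x_i$ if $i\in B(x)$ and $(x\cdot a)_i=\max(0,\min(C_i,x_i+v_i))$ otherwise. -}

module Defs where

open import Data.Nat using (ℕ)
open import Data.Integer using (ℤ; 0ℤ; _+_; _≤_)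
open import Data.Fin using (Fin)
open import Data.Product using (Σ; _×_)
open import Data.List using (List)
open import Data.List.Membership.Propositional using (_∈_)
open import Relation.Nullary using (¬_)
open import Relation.Binary using (Rel)
open import Level using (0ℓ)

State : ℕ → Set
State d = Fin d → ℤ

_≼_ : ∀ {d} → State d → State d → Set
x ≼ y = ∀ i → x i ≤ y i

InS : ∀ {d} → State d → State d → Set
InS C x = ∀ i → (0ℤ ≤ x i) × (x i ≤ C i)

Critical : ∀ {d} → (C v : State d) → State d → Fin d → Set
Critical C v x i = ¬ ((0ℤ ≤ x i + v i) × (x i + v i ≤ C i))

Blocked : ∀ {d : ℕ} → (C v : State d) → Rel (Fin d) 0ℓ → State d → Fin d → Set
Blocked {d} C v R x i = Σ (Fin d) λ j → Critical C v x j × R j i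

IsInf : ∀ {d} → State d → List (State d) → State d → Set
IsInf C U m = InS C m × (∀ x → x ∈ U → m ≼ x)
              × (∀ y → InS C y → (∀ x → x ∈ U → y ≼ x) → y ≼ m)

IsSup : ∀ {d} → State d → List (State d) → State d → Set
IsSup C U M = InS C M × (∀ x → x ∈ U → x ≼ M)
              × (∀ y → InS C y → (∀ x → x ∈ U → x ≼ y) → M ≼ y)

-- Both inclusions reduce to a statement about a single critical component j.
--  * (⊆) Criticality of j only involves the number x_j + v_j, and
--    m_j ≤ x_j ≤ M_j.  If x_j + v_j leaves [0,C_j] it falls below 0 or
--    exceeds C_j, and then so does m_j + v_j or M_j + v_j respectively
--    (critical-squeeze).
--  * (⊇) In every coordinate j the infimum is attained by a point of U:
--    taking x ∈ U with least x_j, the state m[j ≔ x_j] is still a lower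
--    bound of U lying in 𝒮, hence below m, which forces m_j = x_j
--    (inf-attained; dually sup-attained).  Then j is critical for x exactly
--    when it is critical for m (critical-coordinate).
module Submission where

open import Defs
open import Data.Nat using (ℕ)
open import Data.Fin using (Fin; _≟_)
open import Data.Product using (Σ; _×_; _,_; proj₁; proj₂)
open import Data.Sum using (_⊎_; inj₁; inj₂; [_,_]′)
open import Data.List using (List; []; _∷_)
open import Data.List.Membership.Propositional using (_∈_)
open import Data.List.Relation.Unary.Any using (here; there)
open import Data.List.Relation.Unary.All using (lookup; tabulate; _∷_)
open import Data.Vec.Functional using (Vector; updateAt)
open import Data.Vec.Functional.Properties using (updateAt-updates; updateAt-minimal)
open import Data.Integer using (ℤ; 0ℤ; _+_; _≤_)
open import Data.Integer.Properties
  using (≤-totalOrder; ≤-trans; ≤-antisym; +-monoˡ-≤; _≤?_)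
open import Relation.Binary using (Rel)
open import Relation.Binary.PropositionalEquality using (_≡_; _≢_; refl; sym; subst)
open import Relation.Nullary using (yes; no)
open import Data.Empty using (⊥-elim)
open import Function using (const; _∘_)
open import Function.Bundles using (_⇔_; mk⇔)
open import Level using (0ℓ)

open import Data.List.Extrema ≤-totalOrder
  using (argmin; argmax; argmin-all; argmax-all;
         f[argmin]≤f[⊤]; f[argmin]≤f[xs]; f[⊥]≤f[argmax]; f[xs]≤f[argmax])

least-in-list : ∀ {a} {A : Set a} (f : A → ℤ) (U : List A) → U ≢ [] →
                Σ A λ x → x ∈ U × (∀ z → z ∈ U → f x ≤ f z)
least-in-list f [] U≢[] = ⊥-elim (U≢[] refl)
least-in-list f (a ∷ xs) _ =
  argmin f a xs , argmin-all f (here refl) (tabulate there) ,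
  λ z z∈ → lookup (f[argmin]≤f[⊤] {f = f} a xs ∷ f[argmin]≤f[xs] {f = f} a xs) z∈

greatest-in-list : ∀ {a} {A : Set a} (f : A → ℤ) (U : List A) → U ≢ [] →
                   Σ A λ x → x ∈ U × (∀ z → z ∈ U → f z ≤ f x)
greatest-in-list f [] U≢[] = ⊥-elim (U≢[] refl)
greatest-in-list f (a ∷ xs) _ =
  argmax f a xs , argmax-all f (here refl) (tabulate there) ,
  λ z z∈ → lookup (f[⊥]≤f[argmax] {f = f} a xs ∷ f[xs]≤f[argmax] {f = f} a xs) z∈

_[_≔_] : ∀ {a} {A : Set a} {n} → Vector A n → Fin n → A → Vector A n
x [ j ≔ c ] = updateAt x j (const c)

update-preserves : ∀ {a p} {A : Set a} {n} (P : Fin n → A → Set p)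
                   (x : Vector A n) (j : Fin n) (c : A) →
                   (∀ k → P k (x k)) → P j c → ∀ k → P k ((x [ j ≔ c ]) k)
update-preserves P x j c Px Pc k with k ≟ j
... | yes refl = subst (P k) (sym (updateAt-updates k x)) Pc
... | no k≢j  = subst (P k) (sym (updateAt-minimal k j x k≢j)) (Px k)

-- The infimum of a nonempty finite U ⊆ 𝒮 is attained in every coordinate:
-- for x ∈ U with least x_j, m[j ≔ x_j] is a lower bound of U in 𝒮, so it
-- lies below m, giving x_j ≤ m_j; the reverse inequality holds as m ≼ x.
inf-attained : ∀ {d} (C : State d) (U : List (State d)) → U ≢ [] →
               (∀ x → x ∈ U → InS C x) → (m : State d) → IsInf C U m →
               ∀ j → Σ (State d) λ x → x ∈ U × x j ≡ m j
inf-attained C U U≢[] U⊆𝒮 m (m∈𝒮 , m≼U , m-greatest) j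
  with least-in-list (λ x → x j) U U≢[]
... | x , x∈U , x-least =
  x , x∈U , ≤-antisym (subst (_≤ m j) (updateAt-updates j m) (y≼m j)) (m≼U x x∈U j)
  where
  y : State _
  y = m [ j ≔ x j ]
  y≼m : y ≼ m
  y≼m = m-greatest y
    (update-preserves (λ k t → 0ℤ ≤ t × t ≤ C k) m j (x j) m∈𝒮 (U⊆𝒮 x x∈U j))
    (λ z z∈U → update-preserves (λ k t → t ≤ z k) m j (x j) (m≼U z z∈U) (x-least z z∈U))

sup-attained : ∀ {d} (C : State d) (U : List (State d)) → U ≢ [] →
               (∀ x → x ∈ U → InS C x) → (M : State d) → IsSup C U M →
               ∀ j → Σ (State d) λ x → x ∈ U × x j ≡ M j
sup-attained C U U≢[] U⊆𝒮 M (M∈𝒮 , U≼M , M-least) j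
  with greatest-in-list (λ x → x j) U U≢[]
... | x , x∈U , x-greatest =
  x , x∈U , ≤-antisym (U≼M x x∈U j) (subst (M j ≤_) (updateAt-updates j M) (M≼y j))
  where
  y : State _
  y = M [ j ≔ x j ]
  M≼y : M ≼ y
  M≼y = M-least y
    (update-preserves (λ k t → 0ℤ ≤ t × t ≤ C k) M j (x j) M∈𝒮 (U⊆𝒮 x x∈U j))
    (λ z z∈U → update-preserves (λ k t → z k ≤ t) M j (x j) (U≼M z z∈U) (x-greatest z z∈U))

critical-coordinate : ∀ {d} (C v x y : State d) j →
                      x j ≡ y j → Critical C v x j → Critical C v y j
critical-coordinate C v x y j xj≡yj x-crit =
  x-crit ∘ subst (λ t → (0ℤ ≤ t + v j) × (t + v j ≤ C j)) (sym xj≡yj)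

critical-squeeze : ∀ {d} (C v m x M : State d) j → m j ≤ x j → x j ≤ M j →
                   Critical C v x j → Critical C v m j ⊎ Critical C v M j
critical-squeeze C v m x M j mj≤xj xj≤Mj x-crit
  with 0ℤ ≤? m j + v j | M j + v j ≤? C j
... | no m-low  | _ = inj₁ (m-low ∘ proj₁)
... | yes _ | no M-high = inj₂ (M-high ∘ proj₂)
... | yes m-ok | yes M-ok = ⊥-elim (x-crit
  ( ≤-trans m-ok (+-monoˡ-≤ (v j) mj≤xj)
  , ≤-trans (+-monoˡ-≤ (v j) xj≤Mj) M-ok))

lemma1 : (d : ℕ) (C v : State d) (R : Rel (Fin d) 0ℓ)
         (U : List (State d)) → U ≢ [] → (∀ x → x ∈ U → InS C x)
         → (m M : State d) → IsInf C U m → IsSup C U M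
         → ∀ i → (Σ (State d) λ x → x ∈ U × Blocked C v R x i)
                 ⇔ (Blocked C v R m i ⊎ Blocked C v R M i)
lemma1 d C v R U U≢[] U⊆𝒮 m M inf sup i = mk⇔ to from
  where
  to : (Σ (State d) λ x → x ∈ U × Blocked C v R x i) → Blocked C v R m i ⊎ Blocked C v R M i
  to (x , x∈U , j , x-crit , jRi) =
    [ (λ m-crit → inj₁ (j , m-crit , jRi)) , (λ M-crit → inj₂ (j , M-crit , jRi)) ]′
      (critical-squeeze C v m x M j (proj₁ (proj₂ inf) x x∈U j) (proj₁ (proj₂ sup) x x∈U j) x-crit)

  from : Blocked C v R m i ⊎ Blocked C v R M i → Σ (State d) λ x → x ∈ U × Blocked C v R x i
  from (inj₁ (j , m-crit , jRi)) with inf-attained C U U≢[] U⊆𝒮 m inf j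
  ... | x , x∈U , xj≡mj = x , x∈U , j , critical-coordinate C v m x j (sym xj≡mj) m-crit , jRi
  from (inj₂ (j , M-crit , jRi)) with sup-attained C U U≢[] U⊆𝒮 M sup j
  ... | x , x∈U , xj≡Mj = x , x∈U , j , critical-coordinate C v M x j (sym xj≡Mj) M-crit , jRi
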